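{- Let $n \ge 1$ and let $v$ be an order ideal of the shifted staircase $\mathrm{SS}_n$, with binary representation $s = s_1 s_2 \cdots s_n$. Then $v$ is an Eeta win in the lattice $J(\mathrm{SS}_n)$ if and only if both of the following hold: (i) $s_n = 0$; and (ii) in the string $s_{1:n-1} = s_1\cdots s_{n-1}$ there is no maximal block of consecutive $1$s of odd length that is immediately followed by a maximal block of consecutive $0$s of odd length.
   Context: Ungar game. Let $L$ be a finite meet-semilattice with minimum $\hat 0$. An Ungar move from $v \in L$ sends $v$ to the meet $\bigwedge(\{v\}\cup T)$, where $T$ is a subset of the set of elements covered by $v$; the move is nontrivial if $T \neq \emptyset$. The Ungar game starting at $v$ is played on the interval $[\hat 0, v]$: two players, Atniss (who moves first) and Eeta, alternately make nontrivial Ungar moves; the player who cannot make a nontrivial Ungar move loses. The element $v$ is an Atniss win if Atniss has a winning strategy, and an Eeta win otherwise. Shifted staircase. $\mathrm{SS}_n$ is the poset of lattice points $(i,j)$ with $1 \le i \le j \le n$, ordered by $(i,j)\le(i',j')$ iff $i\le i'$ and $j \le j'$. $J(\mathrm{SS}_n)$ is the lattice of order ideals of $\mathrm{SS}_n$ ordered by inclusion (meet = intersection). An order ideal $v$ is determined by the numbers $\lambda_i$ of its points in row $i$ (points $(i,j)$), whose nonzero values form a strictly decreasing sequence of integers in $\{1,\dots,n\}$. The binary representation of $v$ is the length-$n$ string $s=s_1\cdots s_n$ with $s_k = 1$ iff $n-k+1$ is one of the nonzero $\lambda_i$ (equivalently, reading the lattice path lying directly above $v$, up steps give $1$ and down steps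 give $0$). The rank of $v$ is $\sum_{k=1}^n (n-k+1)s_k$. Equivalently, $u \lessdot v$ in $J(\mathrm{SS}_n)$ iff the binary representation of $u$ is obtained from that $t$ of $v$ either by replacing a consecutive pair $t_it_{i+1}=10$ by $01$, or, when $t_n=1$, by replacing $t_n$ by $0$. A maximal block of $1$s (resp. $0$s) in a string is a maximal substring of consecutive $1$s (resp. $0$s). -}

module Defs where

open import Data.Nat using (ℕ; zero; suc; _+_; _∸_; _≤_; _<_; _%_)
open import Data.Bool using (Bool; true; false; if_then_else_)
open import Data.Bool.Properties using () renaming (_≟_ to _≟B_)
open import Data.List using (List; []; _∷_)
open import Data.List.Relation.Unary.All using (All)
open import Data.Vec using (Vec; []; _∷_)
open import Data.Product using (Σ; _×_; _,_)
open import Data.Sum using (_⊎_)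
open import Data.Empty using (⊥)
open import Relation.Nullary using (¬_; yes; no)
open import Relation.Binary.PropositionalEquality using (_≡_; _≢_)

-- Order ideals of the shifted staircase SS_n, coordinatised by their
-- binary representation s = s_1 ... s_n  (a Vec Bool n; true = 1).
-- This is a bijection (standard), so we identify J(SS_n) with Vec Bool n
-- and recover the actual set of lattice points from s.

-- The nonzero row lengths λ_1 > λ_2 > ... : s_k = 1 contributes n-k+1.
lams : ∀ {n} → Vec Bool n → List ℕ
lams [] = []
lams {suc m} (true  ∷ s) = suc m ∷ lams s
lams {suc m} (false ∷ s) = lams s

-- nth element (0-indexed) with default 0 (rows beyond the last are empty)
nth : List ℕ → ℕ → ℕ
nth [] _ = 0
nth (x ∷ xs) zero = x
nth (x ∷ xs) (suc k) = nth xs k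

rowLen : ∀ {n} → Vec Bool n → ℕ → ℕ
rowLen s i = nth (lams s) (i ∸ 1)

InIdeal : ∀ {n} → Vec Bool n → ℕ → ℕ → Set
InIdeal {n} s i j = (1 ≤ i) × (i ≤ j) × (j ≤ n) × (j < i + rowLen s i)

_≤J_ : ∀ {n} → Vec Bool n → Vec Bool n → Set
u ≤J v = ∀ i j → InIdeal u i j → InIdeal v i j

_<J_ : ∀ {n} → Vec Bool n → Vec Bool n → Set
u <J v = (u ≤J v) × ¬ (v ≤J u)

_⋖J_ : ∀ {n} → Vec Bool n → Vec Bool n → Set
u ⋖J v = (u <J v) × (∀ z → u <J z → z <J v → ⊥)

IsMeet : ∀ {n} → List (Vec Bool n) → Vec Bool n → Set
IsMeet S w = All (w ≤J_) S × (∀ z → All (z ≤J_) S → z ≤J w)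

UngarMove : ∀ {n} → Vec Bool n → Vec Bool n → Set
UngarMove {n} v w =
  Σ (List (Vec Bool n)) λ T → (T ≢ []) × All (_⋖J v) T × IsMeet (v ∷ T) w

data AtnissWin {n} (v : Vec Bool n) : Set where
  win : (w : Vec Bool n) → UngarMove v w →
        ((w' : Vec Bool n) → UngarMove w w' → AtnissWin w') → AtnissWin v

EetaWin : ∀ {n} → Vec Bool n → Set
EetaWin v = ¬ AtnissWin v

-- Maximal blocks: run-length encoding of a bit string, as a list of
-- (bit , length) pairs, consecutive entries having different bits.

addBit : Bool → List (Bool × ℕ) → List (Bool × ℕ)
addBit b [] = (b , 1) ∷ []
addBit b ((c , k) ∷ r) with b ≟B c
... | yes _ = (c , suc k) ∷ r
... | no  _ = (b , 1) ∷ (c , k) ∷ r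

blocks : List Bool → List (Bool × ℕ)
blocks [] = []
blocks (b ∷ bs) = addBit b (blocks bs)

Odd : ℕ → Set
Odd k = k % 2 ≡ 1

OddOnesThenOddZeros : List (Bool × ℕ) → Set
OddOnesThenOddZeros [] = ⊥
OddOnesThenOddZeros (_ ∷ []) = ⊥
OddOnesThenOddZeros ((b , k) ∷ (c , l) ∷ r) =
  ((b ≡ true) × (c ≡ false) × Odd k × Odd l) ⊎ OddOnesThenOddZeros ((c , l) ∷ r)

-- Order ideals are compared through the prefix counts of their strings: u ⊆ v iff every prefix of u
-- contains at most as many 1s as the prefix of v of the same length.  So the ideals covered by v
-- arise by letting a single 1 of v hop one step to the right (into a 0, or off the end), meets of
-- such covers let all the chosen 1s hop at once, and an Ungar move is a nonempty simultaneous hop.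
-- The claimed Eeta wins are the strings accepted by a six-state automaton reading from right to
-- left.  Running it on a string and on all of its hops at once is again a finite-state process, and
-- checking its finitely many reachable states shows that the accepted strings form a kernel of the
-- move graph: no move stays inside, and from outside some move enters it.  As moves lower the rank,
-- that kernel is exactly the set of Eeta wins.

module Submission where

open import Defs
open import Data.Bool using (Bool; true; false; not; _∧_; _∨_; T)
open import Data.Bool.Properties using (T-∨) renaming (_≟_ to _≟B_)
open import Data.Empty using (⊥; ⊥-elim)
open import Data.Fin.Subset using (Subset; ∣_∣; _∪_; ⋃) renaming (⊥ to ∅)
open import Data.Fin.Subset.Properties using (∣⊥∣≡0; ∣p∣≤∣p∪q∣; ∪-identityˡ)
open import Data.List using (List; []; _∷_; _++_; map; concatMap; filter; deduplicate)
open import Data.List.Membership.Propositional using (_∈_; find)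
open import Data.List.Membership.Propositional.Properties using (∈-map⁺; ∈-concatMap⁺; ∈-filter⁺; ∈-filter⁻)
open import Data.List.Properties using () renaming (≡-dec to ≡-decList)
open import Data.List.Relation.Unary.All as All using (All; []; _∷_)
open import Data.List.Relation.Unary.All.Properties using (map⁺; map⁻)
open import Data.List.Relation.Unary.Any as Any using (Any; here; there; any?)
open import Data.Nat using (ℕ; zero; suc; _+_; _*_; _∸_; _≤_; _<_; z≤n; s≤s; _≤?_; _<ᵇ_; _≟_)
open import Data.Nat.GeneralisedArithmetic using (iterate)
open import Data.Nat.Induction using (<-wellFounded)
open import Data.Nat.Properties
open import Data.Nat.Tactic.RingSolver using (solve-∀)
open import Data.Product using (∃; ∃₂; _×_; _,_; proj₁; proj₂)
open import Data.Sum using (_⊎_; inj₁; inj₂; [_,_]′)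
open import Data.Unit using (⊤; tt)
open import Data.Vec using (Vec; []; _∷_; last; init; toList)
open import Data.Vec.Properties using () renaming (≡-dec to ≡-decVec)
open import Function.Base using (_∘_)
open import Function.Bundles using (Equivalence; _⇔_; mk⇔)
open import Function.Properties.Equivalence using () renaming (trans to ⇔-trans)
open import Induction.WellFounded using (Acc; acc)
open import Relation.Binary using (DecidableEquality)
open import Relation.Binary.PropositionalEquality
open import Relation.Nullary using (¬_; yes; no)
open import Relation.Nullary.Decidable using (Dec; map′; _×-dec_; _→-dec_; ¬?; T?; from-yes)
open import Relation.Unary using (Decidable)

bit : Bool → ℕ
bit false = 0
bit true  = 1

-- Order ideals as strings

nth-lams-bound : ∀ {n} (s : Vec Bool n) k → nth (lams s) k ≡ 0 ⊎ nth (lams s) k + k ≤ n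
nth-lams-bound []                   k       = inj₁ refl
nth-lams-bound {suc n} (true  ∷ s)  zero    = inj₂ (≤-reflexive (+-identityʳ (suc n)))
nth-lams-bound {suc n} (true  ∷ s)  (suc k) with nth-lams-bound s k
... | inj₁ eq = inj₁ eq
... | inj₂ le = inj₂ (≤-trans (≤-reflexive (+-suc _ k)) (s≤s le))
nth-lams-bound {suc n} (false ∷ s)  k       with nth-lams-bound s k
... | inj₁ eq = inj₁ eq
... | inj₂ le = inj₂ (≤-trans le (n≤1+n n))

nth-lams-≤ : ∀ {n} (s : Vec Bool n) k → nth (lams s) k ≤ n
nth-lams-≤ s k with nth-lams-bound s k
... | inj₁ eq = subst (_≤ _) (sym eq) z≤n
... | inj₂ le = ≤-trans (m≤m+n _ k) le

nth-∷-+suc : ∀ x xs d k → nth (x ∷ xs) (d + suc k) ≡ nth xs (d + k)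
nth-∷-+suc x xs d k rewrite +-suc d k = refl

ones : ∀ {n} → ℕ → Vec Bool n → ℕ
ones zero    _       = 0
ones (suc q) []      = 0
ones (suc q) (b ∷ v) = bit b + ones q v

-- t ≤[ d ] v : every prefix of t contains at most d more 1s than the prefix of v of the same length.
infix 4 _≤[_]_
data _≤[_]_ : ∀ {n} → Vec Bool n → ℕ → Vec Bool n → Set where
  []    : ∀ {d} → [] ≤[ d ] []
  keep  : ∀ {n d b} {t v : Vec Bool n} → t ≤[ d ] v → b ∷ t ≤[ d ] b ∷ v
  lend  : ∀ {n d} {t v : Vec Bool n} → t ≤[ suc d ] v → false ∷ t ≤[ d ] true ∷ v
  repay : ∀ {n d} {t v : Vec Bool n} → t ≤[ d ] v → true ∷ t ≤[ suc d ] false ∷ v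

RowsBelow : ∀ {n} → ℕ → Vec Bool n → Vec Bool n → Set
RowsBelow d u v = ∀ k → nth (lams u) (d + k) ≤ nth (lams v) k

rowsBelow⇒ones : ∀ {n} d (u v : Vec Bool n) → RowsBelow d u v → ∀ q → ones q u ≤ d + ones q v
rowsBelow⇒ones d u v r zero = z≤n
rowsBelow⇒ones d [] [] r (suc q) = z≤n
rowsBelow⇒ones d (false ∷ u) (false ∷ v) r (suc q) = rowsBelow⇒ones d u v r q
rowsBelow⇒ones d (true ∷ u) (true ∷ v) r (suc q) =
  ≤-trans (s≤s (rowsBelow⇒ones d u v (λ k → subst (_≤ _) (nth-∷-+suc _ _ d k) (r (suc k))) q))
          (≤-reflexive (sym (+-suc d _)))
rowsBelow⇒ones d (false ∷ u) (true ∷ v) r (suc q) =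
  ≤-trans (rowsBelow⇒ones (suc d) u v (λ k → subst (_≤ _) (cong (nth (lams u)) (+-suc d k)) (r (suc k))) q)
          (≤-reflexive (sym (+-suc d _)))
rowsBelow⇒ones {suc n} zero (true ∷ u) (false ∷ v) r (suc q) = ⊥-elim (1+n≰n (≤-trans (r 0) (nth-lams-≤ v 0)))
rowsBelow⇒ones (suc d) (true ∷ u) (false ∷ v) r (suc q) = s≤s (rowsBelow⇒ones d u v r q)

ones⇒≤[d] : ∀ {n} d (u v : Vec Bool n) → (∀ q → ones q u ≤ d + ones q v) → u ≤[ d ] v
ones⇒≤[d] d [] [] h = []
ones⇒≤[d] d (false ∷ u) (false ∷ v) h = keep (ones⇒≤[d] d u v (λ q → h (suc q)))
ones⇒≤[d] d (true ∷ u) (true ∷ v) h =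
  keep (ones⇒≤[d] d u v (λ q → ≤-pred (≤-trans (h (suc q)) (≤-reflexive (+-suc d _)))))
ones⇒≤[d] d (false ∷ u) (true ∷ v) h =
  lend (ones⇒≤[d] (suc d) u v (λ q → ≤-trans (h (suc q)) (≤-reflexive (+-suc d _))))
ones⇒≤[d] zero (true ∷ u) (false ∷ v) h with h 1
... | ()
ones⇒≤[d] (suc d) (true ∷ u) (false ∷ v) h = repay (ones⇒≤[d] d u v (λ q → ≤-pred (h (suc q))))

≤[d]⇒rowsBelow : ∀ {n d} {u v : Vec Bool n} → u ≤[ d ] v → RowsBelow d u v
≤[d]⇒rowsBelow [] k = z≤n
≤[d]⇒rowsBelow (keep {b = false} h) = ≤[d]⇒rowsBelow h
≤[d]⇒rowsBelow {d = d} (keep {b = true} {t} h) zero =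
  subst (λ i → nth (lams (true ∷ t)) i ≤ _) (sym (+-identityʳ d)) (nth-lams-≤ (true ∷ t) d)
≤[d]⇒rowsBelow {d = d} (keep {b = true} {t} h) (suc k) =
  subst (_≤ _) (sym (nth-∷-+suc _ _ d k)) (≤[d]⇒rowsBelow h k)
≤[d]⇒rowsBelow {d = d} (lend {t = t} h) zero =
  subst (λ i → nth (lams t) i ≤ _) (sym (+-identityʳ d)) (≤-trans (nth-lams-≤ t d) (n≤1+n _))
≤[d]⇒rowsBelow {d = d} (lend {t = t} h) (suc k) =
  subst (_≤ _) (cong (nth (lams t)) (sym (+-suc d k))) (≤[d]⇒rowsBelow h k)
≤[d]⇒rowsBelow (repay h) = ≤[d]⇒rowsBelow h

≤J⇒rowsBelow : ∀ {n} (u v : Vec Bool n) → u ≤J v → RowsBelow 0 u v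
≤J⇒rowsBelow {n} u v u≤v k with nth (lams u) k ≤? nth (lams v) k
... | yes le = le
... | no ¬le = ⊥-elim (<-irrefl refl (proj₂ (proj₂ (proj₂ (u≤v (suc k) (suc k + b) point)))))
  where
  a : ℕ
  a = nth (lams u) k
  b : ℕ
  b = nth (lams v) k
  b<a : b < a
  b<a = ≰⇒> ¬le
  a+k≤n : a + k ≤ n
  a+k≤n with nth-lams-bound u k
  ... | inj₁ eq = ⊥-elim (n≮0 (subst (b <_) eq b<a))
  ... | inj₂ le = le
  -- the point of row k+1 just beyond the end of that row of v
  point : InIdeal u (suc k) (suc k + b)
  point = s≤s z≤n , m≤m+n (suc k) b ,
          ≤-trans (≤-reflexive (sym (+-suc k b)))
                  (≤-trans (+-monoʳ-≤ k b<a) (≤-trans (≤-reflexive (+-comm k a)) a+k≤n)) ,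
          +-monoʳ-< (suc k) b<a

rowsBelow⇒≤J : ∀ {n} (u v : Vec Bool n) → RowsBelow 0 u v → u ≤J v
rowsBelow⇒≤J u v r i j (1≤i , i≤j , j≤n , j<i+λ) =
  1≤i , i≤j , j≤n , <-≤-trans j<i+λ (+-monoʳ-≤ i (r (i ∸ 1)))

≤J⇒ones : ∀ {n} (u v : Vec Bool n) → u ≤J v → ∀ q → ones q u ≤ ones q v
≤J⇒ones u v u≤v = rowsBelow⇒ones 0 u v (≤J⇒rowsBelow u v u≤v)

≤J⇒≤[0] : ∀ {n} (u v : Vec Bool n) → u ≤J v → u ≤[ 0 ] v
≤J⇒≤[0] u v u≤v = ones⇒≤[d] 0 u v (≤J⇒ones u v u≤v)

≤[0]⇒≤J : ∀ {n} {u v : Vec Bool n} → u ≤[ 0 ] v → u ≤J v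
≤[0]⇒≤J {u = u} {v} h = rowsBelow⇒≤J u v (≤[d]⇒rowsBelow h)

ones⇒≤J : ∀ {n} {u v : Vec Bool n} → (∀ q → ones q u ≤ ones q v) → u ≤J v
ones⇒≤J {u = u} {v} h = ≤[0]⇒≤J (ones⇒≤[d] 0 u v h)

≤[0]-antisym : ∀ {n} {u v : Vec Bool n} → u ≤[ 0 ] v → v ≤[ 0 ] u → u ≡ v
≤[0]-antisym []       []       = refl
≤[0]-antisym (keep h) (keep g) = cong (_ ∷_) (≤[0]-antisym h g)

≤J-antisym : ∀ {n} (u v : Vec Bool n) → u ≤J v → v ≤J u → u ≡ v
≤J-antisym u v u≤v v≤u = ≤[0]-antisym (≤J⇒≤[0] u v u≤v) (≤J⇒≤[0] v u v≤u)

≤J-refl : ∀ {n} {v : Vec Bool n} → v ≤J v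
≤J-refl i j p = p

-- Ungar moves as simultaneous hops

vacant : ∀ {n} → Vec Bool n → Bool
vacant []      = true
vacant (b ∷ _) = not b

-- The 1s selected by p each hop one step to the right, into a 0 or off the end of the string.
data Hops : ∀ {n} → Subset n → Vec Bool n → Set where
  []   : Hops [] []
  stay : ∀ {n b} {p v : Vec Bool n} → Hops p v → Hops (false ∷ p) (b ∷ v)
  jump : ∀ {n} {p v : Vec Bool n} → T (vacant v) → Hops p v → Hops (true ∷ p) (true ∷ v)

Hops-tail : ∀ {n x b} {p v : Vec Bool n} → Hops (x ∷ p) (b ∷ v) → Hops p v
Hops-tail (stay h)   = h
Hops-tail (jump _ h) = h

Hops-landing : ∀ {n x b} {p v : Vec Bool n} → Hops (x ∷ p) (b ∷ v) → T x → T (vacant v)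
Hops-landing (jump a _) _ = a

-- The carry c records whether a 1 hops into v from the left.
hopWith : ∀ {n} → Bool → Subset n → Vec Bool n → Vec Bool n
hopWith c []      []      = []
hopWith c (x ∷ p) (b ∷ v) = (b ∧ not x ∨ c) ∷ hopWith x p v

hop : ∀ {n} → Subset n → Vec Bool n → Vec Bool n
hop = hopWith false

hop-balance : ∀ {n x b} c {p v : Vec Bool n} → Hops (x ∷ p) (b ∷ v) → (T c → T (not b)) →
              bit (b ∧ not x ∨ c) + bit x ≡ bit b + bit c
hop-balance {b = false} false (stay _)   _  = refl
hop-balance {b = false} true  (stay _)   _  = refl
hop-balance {b = true}  false (stay _)   _  = refl
hop-balance {b = true}  true  (stay _)   cv = ⊥-elim (cv _)
hop-balance             false (jump _ _) _  = refl
hop-balance             true  (jump _ _) cv = ⊥-elim (cv _)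

∣∷∣ : ∀ {n} x (p : Subset n) → ∣ x ∷ p ∣ ≡ bit x + ∣ p ∣
∣∷∣ false p = refl
∣∷∣ true  p = refl

Hops-∅ : ∀ {n} (v : Vec Bool n) → Hops ∅ v
Hops-∅ []      = []
Hops-∅ (b ∷ v) = stay (Hops-∅ v)

hop-∅ : ∀ {n} (v : Vec Bool n) → hop ∅ v ≡ v
hop-∅ []          = refl
hop-∅ (false ∷ v) = cong (false ∷_) (hop-∅ v)
hop-∅ (true  ∷ v) = cong (true ∷_) (hop-∅ v)

rank : ∀ {n} → Vec Bool n → ℕ
rank []              = 0
rank {suc n} (b ∷ v) = bit b * suc n + rank v

rank-hopWith : ∀ {n} c {p v : Vec Bool n} → Hops p v → (T c → T (vacant v)) →
               rank (hopWith c p v) + ∣ p ∣ ≡ rank v + bit c * n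
rank-hopWith c [] _ = sym (*-zeroʳ (bit c))
rank-hopWith {suc n} c {x ∷ p} {b ∷ v} h cv = begin
  hb * suc n + R + ∣ x ∷ p ∣          ≡⟨ cong (hb * suc n + R +_) (∣∷∣ x p) ⟩
  hb * suc n + R + (bit x + ∣ p ∣)    ≡⟨ regroup (hb * suc n) R (bit x) ∣ p ∣ ⟩
  hb * suc n + bit x + (R + ∣ p ∣)    ≡⟨ cong (hb * suc n + bit x +_) IH ⟩
  hb * suc n + bit x + (V + bit x * n) ≡⟨ collect hb (bit x) V n ⟩
  (hb + bit x) * suc n + V            ≡⟨ cong (λ k → k * suc n + V) (hop-balance c h cv) ⟩
  (bit b + bit c) * suc n + V         ≡⟨ distribute (bit b) (bit c) V n ⟩
  bit b * suc n + V + bit c * suc n   ∎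
  where
  open ≡-Reasoning
  hb : ℕ
  hb = bit (b ∧ not x ∨ c)
  R : ℕ
  R = rank (hopWith x p v)
  V : ℕ
  V = rank v
  IH : R + ∣ p ∣ ≡ V + bit x * n
  IH = rank-hopWith x (Hops-tail h) (Hops-landing h)
  regroup : ∀ a r x s → a + r + (x + s) ≡ a + x + (r + s)
  regroup = solve-∀
  collect : ∀ a x v n → a * suc n + x + (v + x * n) ≡ (a + x) * suc n + v
  collect = solve-∀
  distribute : ∀ a c v n → (a + c) * suc n + v ≡ a * suc n + v + c * suc n
  distribute = solve-∀

rank-hop : ∀ {n} {p v : Vec Bool n} → Hops p v → rank (hop p v) + ∣ p ∣ ≡ rank v
rank-hop h = trans (rank-hopWith false h (λ ())) (+-identityʳ _)

-- Whether a hop of p crosses from position q to q + 1; the hop at the last position leaves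
-- the string, and hence every prefix of length at least n.
exits : ∀ {n} → ℕ → Subset n → Bool
exits zero          _               = false
exits (suc q)       []              = false
exits (suc q)       (x ∷ [])        = x
exits (suc zero)    (x ∷ _ ∷ _)     = x
exits (suc (suc q)) (_ ∷ p@(_ ∷ _)) = exits (suc q) p

+-balance : ∀ h r e b v c x → r + e ≡ v + x → h + x ≡ b + c → h + r + e ≡ b + v + c
+-balance h r e b v c x re hx = begin
  h + r + e       ≡⟨ +-assoc h r e ⟩
  h + (r + e)     ≡⟨ cong (h +_) re ⟩
  h + (v + x)     ≡⟨ shuffle h v x ⟩
  h + x + v       ≡⟨ cong (_+ v) hx ⟩
  b + c + v       ≡⟨ shuffle′ b c v ⟩
  b + v + c       ∎
  where
  open ≡-Reasoning
  shuffle : ∀ a b c → a + (b + c) ≡ a + c + b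
  shuffle = solve-∀
  shuffle′ : ∀ a b c → a + b + c ≡ a + c + b
  shuffle′ = solve-∀

ones-hopWith : ∀ {n} c {p v : Vec Bool (suc n)} → Hops p v → (T c → T (vacant v)) → ∀ q →
               ones (suc q) (hopWith c p v) + bit (exits (suc q) p) ≡ ones (suc q) v + bit c
ones-hopWith c {x ∷ []} {b ∷ []} h cv q =
  +-balance _ (ones q []) (bit x) (bit b) (ones q []) (bit c) _ refl (hop-balance c h cv)
ones-hopWith c {x ∷ _ ∷ _} {b ∷ _ ∷ _} h cv zero =
  +-balance _ 0 (bit x) (bit b) 0 (bit c) _ refl (hop-balance c h cv)
ones-hopWith c {x ∷ p@(_ ∷ _)} {b ∷ v@(_ ∷ _)} h cv (suc q) =
  +-balance _ (ones (suc q) (hopWith x p v)) (bit (exits (suc q) p)) (bit b) (ones (suc q) v) (bit c) _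
            (ones-hopWith x (Hops-tail h) (Hops-landing h) q) (hop-balance c h cv)

ones-hop : ∀ {n} {p v : Vec Bool n} → Hops p v → ∀ q → ones q (hop p v) + bit (exits q p) ≡ ones q v
ones-hop h            zero    = refl
ones-hop []           (suc q) = refl
ones-hop h@(stay _)   (suc q) = trans (ones-hopWith false h (λ ()) q) (+-identityʳ _)
ones-hop h@(jump _ _) (suc q) = trans (ones-hopWith false h (λ ()) q) (+-identityʳ _)

hop-≤J : ∀ {n} {p v : Vec Bool n} → Hops p v → hop p v ≤J v
hop-≤J {p = p} {v} h = ones⇒≤J λ q → subst (ones q (hop p v) ≤_) (ones-hop h q) (m≤m+n _ _)

hop-antitone : ∀ {n} {p r v : Vec Bool n} → Hops p v → Hops r v →
               (∀ q → T (exits q p) → T (exits q r)) → hop r v ≤J hop p v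
hop-antitone {p = p} {r} hp hr p⊆r = ones⇒≤J λ q →
  ≤-from-balance (exits q r) (exits q p) (ones-hop hr q) (ones-hop hp q) (p⊆r q)
  where
  ≤-from-balance : ∀ {a b c} u e → a + bit u ≡ c → b + bit e ≡ c → (T e → T u) → a ≤ b
  ≤-from-balance {a} {b} u false au be _ = subst (a ≤_) (trans au (trans (sym be) (+-identityʳ b))) (m≤m+n a _)
  ≤-from-balance {a} {b} true true au be _ = ≤-reflexive (+-cancelʳ-≡ 1 a b (trans au (sym be)))
  ≤-from-balance false true au be e⇒u = ⊥-elim (e⇒u _)

exits-∅ : ∀ {n} q → exits q (∅ {n}) ≡ false
exits-∅             zero          = refl
exits-∅ {zero}      (suc q)       = refl
exits-∅ {suc zero}  (suc q)       = refl
exits-∅ {suc (suc n)} (suc zero)    = refl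
exits-∅ {suc (suc n)} (suc (suc q)) = exits-∅ {suc n} (suc q)

exits-∪ : ∀ {n} q (p r : Subset n) → exits q (p ∪ r) ≡ exits q p ∨ exits q r
exits-∪ zero          p                 r                 = refl
exits-∪ (suc q)       []                []                = refl
exits-∪ (suc q)       (x ∷ [])          (y ∷ [])          = refl
exits-∪ (suc zero)    (x ∷ _ ∷ _)       (y ∷ _ ∷ _)       = refl
exits-∪ (suc (suc q)) (_ ∷ p@(_ ∷ _))   (_ ∷ r@(_ ∷ _))   = exits-∪ (suc q) p r

exits-⋃⁺ : ∀ {n} q {es : List (Subset n)} → Any (T ∘ exits q) es → T (exits q (⋃ es))
exits-⋃⁺ q {e ∷ es} (here t)  = subst T (sym (exits-∪ q e (⋃ es))) (Equivalence.from T-∨ (inj₁ t))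
exits-⋃⁺ q {e ∷ es} (there a) = subst T (sym (exits-∪ q e (⋃ es))) (Equivalence.from T-∨ (inj₂ (exits-⋃⁺ q a)))

exits-⋃⁻ : ∀ {n} q (es : List (Subset n)) → T (exits q (⋃ es)) → Any (T ∘ exits q) es
exits-⋃⁻ q []       t = ⊥-elim (subst T (exits-∅ q) t)
exits-⋃⁻ q (e ∷ es) t with Equivalence.to T-∨ (subst T (exits-∪ q e (⋃ es)) t)
... | inj₁ te = here te
... | inj₂ tU = there (exits-⋃⁻ q es tU)

Hops-∪ : ∀ {n} {p r v : Vec Bool n} → Hops p v → Hops r v → Hops (p ∪ r) v
Hops-∪ []          []          = []
Hops-∪ (stay h)    (stay g)    = stay (Hops-∪ h g)
Hops-∪ (stay h)    (jump a g)  = jump a (Hops-∪ h g)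
Hops-∪ (jump a h)  (stay g)    = jump a (Hops-∪ h g)
Hops-∪ (jump a h)  (jump _ g)  = jump a (Hops-∪ h g)

Hops-⋃ : ∀ {n} {v : Vec Bool n} {es} → All (λ e → Hops e v) es → Hops (⋃ es) v
Hops-⋃ {v = v} []       = Hops-∅ v
Hops-⋃         (h ∷ hs) = Hops-∪ h (Hops-⋃ hs)

meet-unique : ∀ {n} {S : List (Vec Bool n)} {w w′} → IsMeet S w → IsMeet S w′ → w ≡ w′
meet-unique {w = w} {w′} (lw , gw) (lw′ , gw′) = ≤J-antisym w w′ (gw′ w lw) (gw w′ lw′)

exits⇒ones< : ∀ {n} {e v : Vec Bool n} q → Hops e v → T (exits q e) → ones q (hop e v) < ones q v
exits⇒ones< {e = e} {v} q h t with exits q e | ones-hop h q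
... | true | eq = subst (ones q (hop e v) <_) eq (≤-reflexive (+-comm 1 _))

-- Meets are pointwise minima of the prefix counts, and a hop lowers the count of each prefix it exits by one.
hops-meet : ∀ {n} {v : Vec Bool n} es → All (λ e → Hops e v) es →
            IsMeet (v ∷ map (λ e → hop e v) es) (hop (⋃ es) v)
hops-meet {v = v} es hs = hop-≤J hU ∷ map⁺ (All.tabulate lower) , greatest
  where
  hU : Hops (⋃ es) v
  hU = Hops-⋃ hs
  lower : ∀ {e} → e ∈ es → hop (⋃ es) v ≤J hop e v
  lower e∈ = hop-antitone (All.lookup hs e∈) hU λ q t → exits-⋃⁺ q (Any.map (λ { refl → t }) e∈)
  below : ∀ {a c z} u → a + bit u ≡ c → z ≤ c → (T u → z < c) → z ≤ a
  below {a} false eq z≤c _   = ≤-trans z≤c (≤-reflexive (trans (sym eq) (+-identityʳ a)))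
  below {a} true  eq _   z<c = ≤-pred (≤-trans (z<c _) (≤-reflexive (trans (sym eq) (+-comm a 1))))
  greatest : ∀ z → All (z ≤J_) (v ∷ map (λ e → hop e v) es) → z ≤J hop (⋃ es) v
  greatest z (z≤v ∷ z≤hops) = ones⇒≤J λ q →
    below (exits q (⋃ es)) (ones-hop hU q) (≤J⇒ones z v z≤v q) λ t →
      All.lookupWith (λ {e} (z≤e , he) t′ → ≤-<-trans (≤J⇒ones z (hop e v) z≤e q) (exits⇒ones< q he t′))
                     (All.zip (map⁻ z≤hops , hs)) (exits-⋃⁻ q es t)

≤-by : ∀ a k {b} → a + k ≡ b → a ≤ b
≤-by a k eq = subst (a ≤_) eq (m≤m+n a k)

rank-mono : ∀ {n d} {t v : Vec Bool n} → t ≤[ d ] v → rank t ≤ rank v + d * n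
rank-mono [] = z≤n
rank-mono {suc m} {d} (keep {b = b} {t} {v} h) = begin
  B + rank t                 ≤⟨ +-monoʳ-≤ B (rank-mono h) ⟩
  B + (rank v + d * m)       ≤⟨ ≤-by _ d (shift B (rank v) d m) ⟩
  B + rank v + d * suc m     ∎
  where
  open ≤-Reasoning
  B : ℕ
  B = bit b * suc m
  shift : ∀ b r d m → b + (r + d * m) + d ≡ b + r + d * suc m
  shift = solve-∀
rank-mono {suc m} {d} (lend {t = t} {v} h) = begin
  rank t                     ≤⟨ rank-mono h ⟩
  rank v + suc d * m         ≤⟨ ≤-by _ (suc d) (shift (rank v) d m) ⟩
  1 * suc m + rank v + d * suc m ∎
  where
  open ≤-Reasoning
  shift : ∀ r d m → r + suc d * m + suc d ≡ 1 * suc m + r + d * suc m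
  shift = solve-∀
rank-mono {suc m} {suc d} (repay {t = t} {v} h) = begin
  1 * suc m + rank t              ≤⟨ +-monoʳ-≤ (1 * suc m) (rank-mono h) ⟩
  1 * suc m + (rank v + d * m)    ≤⟨ ≤-by _ d (shift (rank v) d m) ⟩
  0 * suc m + rank v + suc d * suc m ∎
  where
  open ≤-Reasoning
  shift : ∀ r d m → 1 * suc m + (r + d * m) + d ≡ 0 * suc m + r + suc d * suc m
  shift = solve-∀

rank-strict : ∀ {n} {t v : Vec Bool n} → t ≤[ 0 ] v → t ≢ v → rank t < rank v
rank-strict [] t≢v = ⊥-elim (t≢v refl)
rank-strict {suc m} (keep {b = b} h) t≢v = +-monoʳ-< (bit b * suc m) (rank-strict h (t≢v ∘ cong (b ∷_)))
rank-strict {suc m} (lend {t = t} {v} h) _ = begin-strict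
  rank t                 ≤⟨ rank-mono h ⟩
  rank v + 1 * m         <⟨ ≤-reflexive (shift (rank v) m) ⟩
  1 * suc m + rank v     ∎
  where
  open ≤-Reasoning
  shift : ∀ r m → suc (r + 1 * m) ≡ 1 * suc m + r
  shift = solve-∀

rank-<J : ∀ {n} (u v : Vec Bool n) → u <J v → rank u < rank v
rank-<J u v (u≤v , v≰u) = rank-strict (≤J⇒≤[0] u v u≤v) λ { refl → v≰u (≤J-refl {v = u}) }

rank-single-hop : ∀ {n} {p v : Vec Bool n} → Hops p v → ∣ p ∣ ≡ 1 → suc (rank (hop p v)) ≡ rank v
rank-single-hop {p = p} {v} h one = trans (+-comm 1 _) (subst (λ k → rank (hop p v) + k ≡ rank v) one (rank-hop h))

single-hop-⋖J : ∀ {n} {p v : Vec Bool n} → Hops p v → ∣ p ∣ ≡ 1 → hop p v ⋖J v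
single-hop-⋖J {p = p} {v} h one = (hop-≤J h , v≰hop) , nothing-between
  where
  v≰hop : ¬ v ≤J hop p v
  v≰hop v≤hop = 1+n≢n (trans (rank-single-hop h one) (cong rank (≤J-antisym v (hop p v) v≤hop (hop-≤J h))))
  nothing-between : ∀ z → hop p v <J z → z <J v → ⊥
  nothing-between z hop<z z<v =
    <⇒≱ (rank-<J (hop p v) z hop<z) (≤-pred (subst (rank z <_) (sym (rank-single-hop h one)) (rank-<J z v z<v)))

∣true∷∅∣ : ∀ {n} → ∣ true ∷ ∅ {n} ∣ ≡ 1
∣true∷∅∣ {n} = cong suc (∣⊥∣≡0 n)

-- Below t ≤[ suc d ] v some single hop keeps v above t: either a 1 entering v from the left, which
-- uses up one unit of slack, or a hop inside v.
data SingleHop {n} (d : ℕ) (t v : Vec Bool n) : Set where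
  enter  : T (vacant v) → t ≤[ d ] hopWith true ∅ v → SingleHop d t v
  inside : ∀ {p} → Hops p v → ∣ p ∣ ≡ 1 → t ≤[ suc d ] hop p v → SingleHop d t v

singleHop : ∀ {n d} {t v : Vec Bool n} → t ≤[ suc d ] v → SingleHop d t v
singleHop []                               = enter _ []
singleHop (keep {b = false} {v = v} h)     = enter _ (lend (subst (_ ≤[ _ ]_) (sym (hop-∅ v)) h))
singleHop (keep {n} {b = true} {v = v} h) with singleHop h
... | enter a h′      = inside (jump a (Hops-∅ v)) (∣true∷∅∣ {n}) (repay h′)
... | inside hp one h′ = inside (stay hp) one (keep h′)
singleHop (lend {n} {v = v} h) with singleHop h
... | enter a h′      = inside (jump a (Hops-∅ v)) (∣true∷∅∣ {n}) (keep h′)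
... | inside hp one h′ = inside (stay hp) one (lend h′)
singleHop (repay {v = v} h) = enter _ (keep (subst (_ ≤[ _ ]_) (sym (hop-∅ v)) h))

below-single-hop : ∀ {n} {t v : Vec Bool n} → t ≤[ 0 ] v → t ≢ v →
                   ∃ λ p → Hops p v × ∣ p ∣ ≡ 1 × t ≤[ 0 ] hop p v
below-single-hop [] t≢v = ⊥-elim (t≢v refl)
below-single-hop (keep {b = false} h) t≢v with below-single-hop h (t≢v ∘ cong (false ∷_))
... | p , hp , one , h′ = false ∷ p , stay hp , one , keep h′
below-single-hop (keep {b = true} h) t≢v with below-single-hop h (t≢v ∘ cong (true ∷_))
... | p , hp , one , h′ = false ∷ p , stay hp , one , keep h′
below-single-hop (lend {n} {v = v} h) _ with singleHop h
... | enter a h′       = true ∷ ∅ , jump a (Hops-∅ v) , ∣true∷∅∣ {n} , keep h′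
... | inside hp one h′ = false ∷ _ , stay hp , one , lend h′

⋖J⇒single-hop : ∀ {n} (t v : Vec Bool n) → t ⋖J v → ∃ λ p → Hops p v × ∣ p ∣ ≡ 1 × t ≡ hop p v
⋖J⇒single-hop t v ((t≤v , v≰t) , nothing-between)
  with below-single-hop (≤J⇒≤[0] t v t≤v) (λ { refl → v≰t (≤J-refl {v = t}) })
... | p , hp , one , t≤hop with ≡-decVec _≟B_ t (hop p v)
...   | yes t≡hop = p , hp , one , t≡hop
...   | no  t≢hop = ⊥-elim (nothing-between (hop p v) t<hop (proj₁ (single-hop-⋖J hp one)))
  where
  t<hop : t <J hop p v
  t<hop = ≤[0]⇒≤J t≤hop , λ hop≤t → t≢hop (≤J-antisym t (hop p v) (≤[0]⇒≤J t≤hop) hop≤t)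

singletons : ∀ {n} → Subset n → List (Subset n)
singletons []          = []
singletons (true  ∷ p) = (true ∷ ∅) ∷ map (false ∷_) (singletons p)
singletons (false ∷ p) = map (false ∷_) (singletons p)

⋃-map-false∷ : ∀ {n} (es : List (Subset n)) → ⋃ (map (false ∷_) es) ≡ false ∷ ⋃ es
⋃-map-false∷ []       = refl
⋃-map-false∷ (e ∷ es) = cong ((false ∷ e) ∪_) (⋃-map-false∷ es)

⋃-singletons : ∀ {n} (p : Subset n) → ⋃ (singletons p) ≡ p
⋃-singletons []          = refl
⋃-singletons (true ∷ p)  = begin
  (true ∷ ∅) ∪ ⋃ (map (false ∷_) (singletons p))
    ≡⟨ cong ((true ∷ ∅) ∪_) (⋃-map-false∷ (singletons p)) ⟩
  true ∷ (∅ ∪ ⋃ (singletons p))                  ≡⟨ cong (true ∷_) (∪-identityˡ _) ⟩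
  true ∷ ⋃ (singletons p)                        ≡⟨ cong (true ∷_) (⋃-singletons p) ⟩
  true ∷ p                                       ∎
  where open ≡-Reasoning
⋃-singletons (false ∷ p) = trans (⋃-map-false∷ (singletons p)) (cong (false ∷_) (⋃-singletons p))

singletons-hops : ∀ {n} {p v : Vec Bool n} → Hops p v → All (λ e → Hops e v × ∣ e ∣ ≡ 1) (singletons p)
singletons-hops []                   = []
singletons-hops (stay h)             = map⁺ (All.map (λ (he , one) → stay he , one) (singletons-hops h))
singletons-hops (jump {n} {v = v} a h) =
  (jump a (Hops-∅ v) , ∣true∷∅∣ {n}) ∷ map⁺ (All.map (λ (he , one) → stay he , one) (singletons-hops h))

map-≢[] : ∀ {A B : Set} {f : A → B} {xs : List A} → xs ≢ [] → map f xs ≢ []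
map-≢[] {xs = []}    xs≢[] _ = xs≢[] refl
map-≢[] {xs = _ ∷ _} _     ()

singletons-nonempty : ∀ {n} (p : Subset n) → 0 < ∣ p ∣ → singletons p ≢ []
singletons-nonempty (true ∷ p)  _   ()
singletons-nonempty (false ∷ p) pos = map-≢[] (singletons-nonempty p pos)

HopMove : ∀ {n} → Vec Bool n → Vec Bool n → Set
HopMove v w = ∃ λ p → Hops p v × 0 < ∣ p ∣ × w ≡ hop p v

covers-are-single-hops : ∀ {n} {v : Vec Bool n} ts → All (_⋖J v) ts →
  ∃ λ es → ts ≡ map (λ e → hop e v) es × All (λ e → Hops e v × ∣ e ∣ ≡ 1) es
covers-are-single-hops []       []       = [] , refl , []
covers-are-single-hops {v = v} (t ∷ ts) (c ∷ cs)
  with ⋖J⇒single-hop t v c | covers-are-single-hops {v = v} ts cs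
... | e , he , one , refl | es , refl , singles = e ∷ es , refl , (he , one) ∷ singles

ungarMove⇒hopMove : ∀ {n} {v w : Vec Bool n} → UngarMove v w → HopMove v w
ungarMove⇒hopMove {v = v} (ts , ts≢[] , covers , meet) with covers-are-single-hops {v = v} ts covers
... | [] , refl , _ = ⊥-elim (ts≢[] refl)
... | e ∷ es , refl , singles@((_ , one) ∷ _) =
  ⋃ (e ∷ es) , Hops-⋃ hops , ≤-trans (≤-reflexive (sym one)) (∣p∣≤∣p∪q∣ e (⋃ es)) ,
  meet-unique meet (hops-meet (e ∷ es) hops)
  where
  hops : All (λ e → Hops e v) (e ∷ es)
  hops = All.map proj₁ singles

hopMove⇒ungarMove : ∀ {n} {v w : Vec Bool n} → HopMove v w → UngarMove v w
hopMove⇒ungarMove {v = v} (p , h , pos , refl) =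
  map (λ e → hop e v) (singletons p) ,
  map-≢[] (singletons-nonempty p pos) ,
  map⁺ (All.map (λ (he , one) → single-hop-⋖J he one) (singletons-hops h)) ,
  subst (λ q → IsMeet (v ∷ map (λ e → hop e v) (singletons p)) (hop q v)) (⋃-singletons p)
        (hops-meet (singletons p) (All.map proj₁ (singletons-hops h)))

-- The losing positions form a regular language

-- States of an automaton reading a string from right to left.  A block of 1s is only tracked
-- (evenOnes, oddOnes: the parity of its length so far) when the block of 0s to its right is odd.
data Scan : Set where
  start reject safe oddZeros evenOnes oddOnes : Scan

read : Bool → Scan → Scan
read _     reject   = reject
read false start    = safe
read true  start    = reject
read false safe     = oddZeros
read true  safe     = safe
read false oddZeros = safe
read true  oddZeros = oddOnes
read false evenOnes = oddZeros
read true  evenOnes = oddOnes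
read false oddOnes  = reject
read true  oddOnes  = evenOnes

accepting : Scan → Bool
accepting safe     = true
accepting oddZeros = true
accepting evenOnes = true
accepting _        = false

scan : ∀ {n} → Vec Bool n → Scan
scan []      = start
scan (b ∷ v) = read b (scan v)

scanFrom : Scan → List Bool → Scan
scanFrom g []      = g
scanFrom g (b ∷ l) = read b (scanFrom g l)

scanFrom-reject : ∀ l → scanFrom reject l ≡ reject
scanFrom-reject []      = refl
scanFrom-reject (b ∷ l) = cong (read b) (scanFrom-reject l)

scan-init : ∀ {m} (v : Vec Bool (suc m)) → scan v ≡ scanFrom (read (last v) start) (toList (init v))
scan-init (b ∷ [])         = refl
scan-init (b ∷ v@(_ ∷ _)) = cong (read b) (scan-init v)

Odd-suc : ∀ k → ¬ Odd k → Odd (suc k)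
Odd-suc zero          _  = refl
Odd-suc (suc zero)    ¬o = ⊥-elim (¬o refl)
Odd-suc (suc (suc k)) ¬o = Odd-suc k ¬o

Odd⇒¬Odd-suc : ∀ k → Odd k → ¬ Odd (suc k)
Odd⇒¬Odd-suc (suc zero)    _ ()
Odd⇒¬Odd-suc (suc (suc k)) o = Odd⇒¬Odd-suc k o

OOTZ : List (Bool × ℕ) → Set
OOTZ = OddOnesThenOddZeros

OOTZ-zeros : ∀ {k} r → OOTZ ((false , k) ∷ r) → OOTZ r
OOTZ-zeros (_ ∷ _) (inj₂ o) = o

OOTZ-∷ : ∀ x r → OOTZ r → OOTZ (x ∷ r)
OOTZ-∷ x (_ ∷ _) o = inj₂ o

-- The block decomposition of the part of the string read so far, as seen by each state.
Describes : Scan → List (Bool × ℕ) → Set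
Describes safe     []                              = ⊤
Describes safe     ((false , k) ∷ r)               = ¬ Odd k × ¬ OOTZ r
Describes safe     ((true  , _) ∷ [])              = ⊤
Describes safe     ((true  , _) ∷ (false , l) ∷ r) = ¬ Odd l × ¬ OOTZ r
Describes oddZeros ((false , k) ∷ r)               = Odd k × ¬ OOTZ r
Describes evenOnes ((true  , k) ∷ (false , l) ∷ r) = ¬ Odd k × Odd l × ¬ OOTZ r
Describes oddOnes  ((true  , k) ∷ (false , l) ∷ r) = Odd k × Odd l × ¬ OOTZ r
Describes reject   (_ ∷ r)                         = OOTZ r
Describes _        _                               = ⊥

ones-before-zeros : ∀ k l r → ¬ Odd k ⊎ ¬ Odd l → ¬ OOTZ r → ¬ OOTZ ((true , k) ∷ (false , l) ∷ r)
ones-before-zeros _ _ r (inj₁ ek) _  (inj₁ (_ , _ , ok , _)) = ek ok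
ones-before-zeros _ _ r (inj₂ el) _  (inj₁ (_ , _ , _ , ol)) = el ol
ones-before-zeros _ _ r _         nr (inj₂ o)               = nr (OOTZ-zeros r o)

describes-read : ∀ b g B → Describes g B → Describes (read b g) (addBit b B)
describes-read false safe [] _ = refl , λ ()
describes-read true  safe [] _ = tt
describes-read false safe ((false , k) ∷ r) (ek , nr) = Odd-suc k ek , nr
describes-read true  safe ((false , k) ∷ r) d = d
describes-read false safe ((true , k) ∷ []) _ = refl , λ ()
describes-read true  safe ((true , k) ∷ []) _ = tt
describes-read false safe ((true , k) ∷ (false , l) ∷ r) (el , nr) = refl , ones-before-zeros k l r (inj₂ el) nr
describes-read true  safe ((true , k) ∷ (false , l) ∷ r) d = d
describes-read false oddZeros ((false , k) ∷ r) (ok , nr) = Odd⇒¬Odd-suc k ok , nr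
describes-read true  oddZeros ((false , k) ∷ r) (ok , nr) = refl , ok , nr
describes-read false evenOnes ((true , k) ∷ (false , l) ∷ r) (ek , _ , nr) =
  refl , ones-before-zeros k l r (inj₁ ek) nr
describes-read true  evenOnes ((true , k) ∷ (false , l) ∷ r) (ek , ol , nr) = Odd-suc k ek , ol , nr
describes-read false oddOnes ((true , k) ∷ (false , l) ∷ r) (ok , ol , _) = inj₁ (refl , refl , ok , ol)
describes-read true  oddOnes ((true , k) ∷ (false , l) ∷ r) (ok , ol , nr) = Odd⇒¬Odd-suc k ok , ol , nr
describes-read false reject ((false , k) ∷ r) o = o
describes-read true  reject ((true  , k) ∷ r) o = o
describes-read false reject ((true  , k) ∷ r) o = OOTZ-∷ _ r o
describes-read true  reject ((false , k) ∷ r) o = OOTZ-∷ _ r o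

describes-scan : ∀ l → Describes (scanFrom safe l) (blocks l)
describes-scan []      = tt
describes-scan (b ∷ l) = describes-read b (scanFrom safe l) (blocks l) (describes-scan l)

describes-accepting : ∀ g B → Describes g B → T (accepting g) ⇔ (¬ OOTZ B)
describes-accepting safe [] _ = mk⇔ (λ _ ()) _
describes-accepting safe ((false , k) ∷ r) (_ , nr) = mk⇔ (λ _ → nr ∘ OOTZ-zeros r) _
describes-accepting safe ((true , k) ∷ []) _ = mk⇔ (λ _ ()) _
describes-accepting safe ((true , k) ∷ (false , l) ∷ r) (el , nr) =
  mk⇔ (λ _ → ones-before-zeros k l r (inj₂ el) nr) _
describes-accepting oddZeros ((false , k) ∷ r) (_ , nr) = mk⇔ (λ _ → nr ∘ OOTZ-zeros r) _
describes-accepting evenOnes ((true , k) ∷ (false , l) ∷ r) (ek , _ , nr) =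
  mk⇔ (λ _ → ones-before-zeros k l r (inj₁ ek) nr) _
describes-accepting oddOnes ((true , k) ∷ (false , l) ∷ r) (ok , ol , _) =
  mk⇔ (λ ()) (λ n → n (inj₁ (refl , refl , ok , ol)))
describes-accepting reject (x ∷ r) o = mk⇔ (λ ()) (λ n → n (OOTZ-∷ x r o))

Accepted : ∀ {n} → Vec Bool n → Set
Accepted v = T (accepting (scan v))

accepting-scan : ∀ {m} (v : Vec Bool (suc m)) → Accepted v ⇔ (last v ≡ false × ¬ OOTZ (blocks (toList (init v))))
accepting-scan v rewrite scan-init v with last v
... | true  = mk⇔ (λ t → ⊥-elim (subst (T ∘ accepting) (scanFrom-reject (toList (init v))) t)) λ { (() , _) }
... | false = mk⇔ (λ t → refl , Equivalence.to describes t) (λ (_ , n) → Equivalence.from describes n)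
  where
  describes : T (accepting (scanFrom safe (toList (init v)))) ⇔ (¬ OOTZ (blocks (toList (init v))))
  describes = describes-accepting _ _ (describes-scan (toList (init v)))

-- A finite certificate for the losing positions

scanIndex : Scan → ℕ
scanIndex start    = 0
scanIndex reject   = 1
scanIndex safe     = 2
scanIndex oddZeros = 3
scanIndex evenOnes = 4
scanIndex oddOnes  = 5

scanFromIndex : ℕ → Scan
scanFromIndex 0 = start
scanFromIndex 1 = reject
scanFromIndex 2 = safe
scanFromIndex 3 = oddZeros
scanFromIndex 4 = evenOnes
scanFromIndex _ = oddOnes

scanFromIndex-scanIndex : ∀ g → scanFromIndex (scanIndex g) ≡ g
scanFromIndex-scanIndex start    = refl
scanFromIndex-scanIndex reject   = refl
scanFromIndex-scanIndex safe     = refl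
scanFromIndex-scanIndex oddZeros = refl
scanFromIndex-scanIndex evenOnes = refl
scanFromIndex-scanIndex oddOnes  = refl

_≟Scan_ : DecidableEquality Scan
g ≟Scan g′ = map′ injective (cong scanIndex) (scanIndex g ≟ scanIndex g′)
  where
  injective : scanIndex g ≡ scanIndex g′ → g ≡ g′
  injective eq = trans (sym (scanFromIndex-scanIndex g))
                       (trans (cong scanFromIndex eq) (scanFromIndex-scanIndex g′))

-- What the rest of the string can see of a choice of hops p in a suffix s, when the carry c says
-- whether the last letter before s hops into s.
record Outcome : Set where
  constructor outcome
  field
    carry   : Bool
    scanned : Scan
    moved   : Bool
open Outcome

outcomeOf : ∀ {n} → Bool → Subset n → Vec Bool n → Outcome
outcomeOf c p s = outcome c (scan (hopWith c p s)) (0 <ᵇ ∣ p ∣)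

extend : Bool → Bool → Outcome → Outcome
extend c b (outcome x g m) = outcome c (read (b ∧ not x ∨ c) g) (x ∨ m)

outcomeOf-∷ : ∀ {n} c x b (p s : Vec Bool n) → outcomeOf c (x ∷ p) (b ∷ s) ≡ extend c b (outcomeOf x p s)
outcomeOf-∷ c false b p s = refl
outcomeOf-∷ c true  b p s = refl

admissible : Bool → Bool → Outcome → Bool
admissible b free o = not (carry o) ∨ (b ∧ free)

Hops⇒admissible : ∀ {n x b} {p s : Vec Bool n} → Hops (x ∷ p) (b ∷ s) →
                  T (admissible b (vacant s) (outcomeOf x p s))
Hops⇒admissible (stay _)   = _
Hops⇒admissible (jump a _) = a

admissible⇒Hops : ∀ {n} x b {p s : Vec Bool n} → T (admissible b (vacant s) (outcomeOf x p s)) →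
                  Hops p s → Hops (x ∷ p) (b ∷ s)
admissible⇒Hops false b    _ h = stay h
admissible⇒Hops true  true a h = jump a h

_≟Outcome_ : DecidableEquality Outcome
outcome c g m ≟Outcome outcome c′ g′ m′ with c ≟B c′ | g ≟Scan g′ | m ≟B m′
... | yes refl | yes refl | yes refl = yes refl
... | no  c≢c′ | _        | _        = no (c≢c′ ∘ cong carry)
... | _        | no  g≢g′ | _        = no (g≢g′ ∘ cong scanned)
... | _        | _        | no  m≢m′ = no (m≢m′ ∘ cong moved)

bools : List Bool
bools = false ∷ true ∷ []

scans : List Scan
scans = start ∷ reject ∷ safe ∷ oddZeros ∷ evenOnes ∷ oddOnes ∷ []

∈-bools : ∀ b → b ∈ bools
∈-bools false = here refl
∈-bools true  = there (here refl)

∈-scans : ∀ g → g ∈ scans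
∈-scans start    = here refl
∈-scans reject   = there (here refl)
∈-scans safe     = there (there (here refl))
∈-scans oddZeros = there (there (there (here refl)))
∈-scans evenOnes = there (there (there (there (here refl))))
∈-scans oddOnes  = there (there (there (there (there (here refl)))))

outcomes : List Outcome
outcomes = concatMap (λ c → concatMap (λ g → map (outcome c g) bools) scans) bools

∈-outcomes : ∀ o → o ∈ outcomes
∈-outcomes (outcome c g m) =
  ∈-concatMap⁺ (λ c → concatMap (λ g → map (outcome c g) bools) scans)
    (Any.map (λ { refl → ∈-concatMap⁺ (λ g → map (outcome c g) bools)
                           (Any.map (λ { refl → ∈-map⁺ (outcome c g) (∈-bools m) }) (∈-scans g)) })
             (∈-bools c))

-- All outcomes of all choices of hops in a suffix, together with what is needed to extend them.
record Summary : Set where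
  constructor summary
  field
    state    : Scan
    free     : Bool
    achieved : List Outcome
open Summary

_≟Summary_ : DecidableEquality Summary
summary g f os ≟Summary summary g′ f′ os′ with g ≟Scan g′ | f ≟B f′ | ≡-decList _≟Outcome_ os os′
... | yes refl | yes refl | yes refl = yes refl
... | no  g≢g′ | _        | _        = no (g≢g′ ∘ cong state)
... | _        | no  f≢f′ | _        = no (f≢f′ ∘ cong free)
... | _        | _        | no  o≢o′ = no (o≢o′ ∘ cong achieved)

Extends : Bool → Summary → Outcome → Set
Extends b S o = Any (λ e → T (admissible b (free S) e) × extend (carry o) b e ≡ o) (achieved S)

extends? : ∀ b S → Decidable (Extends b S)
extends? b S o = any? (λ e → T? (admissible b (free S) e) ×-dec (extend (carry o) b e ≟Outcome o)) (achieved S)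

-- Filtering the fixed list outcomes keeps achieved in a canonical order, so equal sets give equal summaries.
step : Bool → Summary → Summary
step b S = summary (read b (state S)) (not b) (filter (extends? b S) outcomes)

summarize : ∀ {n} → Vec Bool n → Summary
summarize []      = summary start true (outcome false start false ∷ outcome true start false ∷ [])
summarize (b ∷ s) = step b (summarize s)

state-summarize : ∀ {n} (s : Vec Bool n) → state (summarize s) ≡ scan s
state-summarize []      = refl
state-summarize (b ∷ s) = cong (read b) (state-summarize s)

free-summarize : ∀ {n} (s : Vec Bool n) → free (summarize s) ≡ vacant s
free-summarize []      = refl
free-summarize (b ∷ s) = refl

achieved-complete : ∀ {n} c {p} (s : Vec Bool n) → Hops p s → outcomeOf c p s ∈ achieved (summarize s)
achieved-complete false [] [] = here refl
achieved-complete true  [] [] = there (here refl)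
achieved-complete c {x ∷ p} (b ∷ s) h = ∈-filter⁺ (extends? b (summarize s)) (∈-outcomes _)
  (Any.map (λ { refl → subst (λ f → T (admissible b f (outcomeOf x p s))) (sym (free-summarize s)) (Hops⇒admissible h)
                     , sym (outcomeOf-∷ c x b p s) })
           (achieved-complete x s (Hops-tail h)))

achieved-sound : ∀ {n} (s : Vec Bool n) {o} → o ∈ achieved (summarize s) →
                 ∃₂ λ c p → Hops p s × outcomeOf c p s ≡ o
achieved-sound [] (here refl)         = false , [] , [] , refl
achieved-sound [] (there (here refl)) = true , [] , [] , refl
achieved-sound (b ∷ s) {o} o∈ with find (proj₂ (∈-filter⁻ (extends? b (summarize s)) {xs = outcomes} o∈))
... | e , e∈ , adm , refl with achieved-sound s e∈
...   | x , p , h , refl =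
  carry o , x ∷ p ,
  admissible⇒Hops x b (subst (λ f → T (admissible b f (outcomeOf x p s))) (free-summarize s) adm) h ,
  outcomeOf-∷ (carry o) x b p s

open import Data.List.Membership.DecPropositional _≟Summary_ using (_∈?_)

grow : List Summary → List Summary
grow R = deduplicate _≟Summary_ (R ++ concatMap (λ S → step false S ∷ step true S ∷ []) R)

-- Nine rounds reach every summary of a nonempty string; the closedness check below is what makes this sound.
summaries : List Summary
summaries = iterate grow (step false (summarize []) ∷ step true (summarize []) ∷ []) 9

Closed : List Summary → Set
Closed R = All (λ S → step false S ∈ R × step true S ∈ R) R

closed? : ∀ R → Dec (Closed R)
closed? R = All.all? (λ S → (step false S ∈? R) ×-dec (step true S ∈? R)) R

summaries-closed : Closed summaries
summaries-closed = from-yes (closed? summaries)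

summaries-start : ∀ b → step b (summarize []) ∈ summaries
summaries-start false = from-yes (step false (summarize []) ∈? summaries)
summaries-start true  = from-yes (step true (summarize []) ∈? summaries)

step-∈ : ∀ b {S R} → step false S ∈ R × step true S ∈ R → step b S ∈ R
step-∈ false = proj₁
step-∈ true  = proj₂

summarize-∈ : ∀ {n} (s : Vec Bool (suc n)) → summarize s ∈ summaries
summarize-∈ (b ∷ [])         = summaries-start b
summarize-∈ (b ∷ s@(_ ∷ _)) = step-∈ b {summarize s} (All.lookup summaries-closed (summarize-∈ s))

Winning : Outcome → Set
Winning o = carry o ≡ false × T (moved o) × T (accepting (scanned o))

winning? : Decidable Winning
winning? o = (carry o ≟B false) ×-dec T? (moved o) ×-dec T? (accepting (scanned o))

Kernel : Summary → Set
Kernel S = (T (accepting (state S)) → All (¬_ ∘ Winning) (achieved S))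
         × (¬ T (accepting (state S)) → Any Winning (achieved S))

kernel? : Decidable Kernel
kernel? S = (T? (accepting (state S)) →-dec All.all? (¬? ∘ winning?) (achieved S))
     ×-dec (¬? (T? (accepting (state S))) →-dec any? winning? (achieved S))

summaries-kernel : All Kernel summaries
summaries-kernel = from-yes (All.all? kernel? summaries)

no-accepting-hop : ∀ {n} {p v : Vec Bool (suc n)} → Accepted v → Hops p v → 0 < ∣ p ∣ → ¬ Accepted (hop p v)
no-accepting-hop {v = v} a h pos a′ =
  All.lookup (proj₁ (All.lookup summaries-kernel (summarize-∈ v)) (subst (T ∘ accepting) (sym (state-summarize v)) a))
             (achieved-complete false v h)
             (refl , <⇒<ᵇ pos , a′)

AcceptingHop : ∀ {n} → Vec Bool n → Set
AcceptingHop v = ∃ λ p → Hops p v × 0 < ∣ p ∣ × Accepted (hop p v)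

accepting-hop : ∀ {n} {v : Vec Bool (suc n)} → ¬ Accepted v → AcceptingHop v
accepting-hop {v = v} rej = realise (find (proj₂ (All.lookup summaries-kernel (summarize-∈ v)) rej′))
  where
  rej′ : ¬ T (accepting (state (summarize v)))
  rej′ = rej ∘ subst (T ∘ accepting) (state-summarize v)
  realise : (∃ λ o → o ∈ achieved (summarize v) × Winning o) → AcceptingHop v
  realise (o , o∈ , c≡false , m , a) with achieved-sound v o∈
  ... | c , p , h , refl with c≡false
  ...   | refl = p , h , <ᵇ⇒< 0 ∣ p ∣ m , a

-- Kernels of the game

rank-decreases : ∀ {n} {v w : Vec Bool n} → UngarMove v w → rank w < rank v
rank-decreases {v = v} {w} m with ungarMove⇒hopMove {v = v} {w} m
... | p , h , pos , refl = begin-strict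
  rank (hop p v)           ≡⟨ +-identityʳ _ ⟨
  rank (hop p v) + 0       <⟨ +-monoʳ-< (rank (hop p v)) pos ⟩
  rank (hop p v) + ∣ p ∣   ≡⟨ rank-hop h ⟩
  rank v                   ∎
  where open ≤-Reasoning

module _ {n} (Losing : Vec Bool n → Set) (losing? : Decidable Losing)
         (stable : ∀ {v w} → Losing v → UngarMove v w → ¬ Losing w)
         (absorbing : ∀ {v} → ¬ Losing v → ∃ λ w → UngarMove v w × Losing w) where

  losing⇒¬AtnissWin : ∀ {v} → Losing v → ¬ AtnissWin v
  losing⇒¬AtnissWin lv (win w vw wins) with absorbing (stable lv vw)
  ... | w′ , ww′ , lw′ = losing⇒¬AtnissWin lw′ (wins w′ ww′)

  ¬losing⇒AtnissWin : ∀ v → Acc _<_ (rank v) → ¬ Losing v → AtnissWin v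
  ¬losing⇒AtnissWin v (acc rs) nl with absorbing nl
  ... | w , vw , lw = win w vw λ w′ ww′ →
    ¬losing⇒AtnissWin w′ (rs (<-trans (rank-decreases {v = w} {w′} ww′) (rank-decreases {v = v} {w} vw)))
                      (stable lw ww′)

  EetaWin⇔Losing : ∀ v → EetaWin v ⇔ Losing v
  EetaWin⇔Losing v = mk⇔ eeta⇒losing losing⇒¬AtnissWin
    where
    eeta⇒losing : EetaWin v → Losing v
    eeta⇒losing ew with losing? v
    ... | yes lv = lv
    ... | no  nl = ⊥-elim (ew (¬losing⇒AtnissWin v (<-wellFounded (rank v)) nl))

accepted-stable : ∀ {n} {v w : Vec Bool (suc n)} → Accepted v → UngarMove v w → ¬ Accepted w
accepted-stable {v = v} {w} a move with ungarMove⇒hopMove {v = v} {w} move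
... | p , h , pos , refl = no-accepting-hop a h pos

accepted-absorbing : ∀ {n} {v : Vec Bool (suc n)} → ¬ Accepted v → ∃ λ w → UngarMove v w × Accepted w
accepted-absorbing {v = v} rej = move (accepting-hop {v = v} rej)
  where
  move : AcceptingHop v → ∃ λ w → UngarMove v w × Accepted w
  move (p , h , pos , a) = hop p v , hopMove⇒ungarMove {v = v} {hop p v} (p , h , pos , refl) , a

theorem1p3 : (m : ℕ) (v : Vec Bool (suc m)) →
    EetaWin v ⇔ ((last v ≡ false) × ¬ OddOnesThenOddZeros (blocks (toList (init v))))
theorem1p3 m v =
  ⇔-trans (EetaWin⇔Losing Accepted (T? ∘ accepting ∘ scan)
                          (λ {v w} → accepted-stable {v = v} {w}) accepted-absorbing v)
          (accepting-scan v)
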